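{- Let $n\ge 2k>1$, let $\mathcal F\subset\binom{[n]}{k}$ with $|\mathcal F|>\binom{n-1}{k-1}$, let $1\le i<k$, and let $P\in\binom{[n]}{i}$ satisfy $|\mathcal F(P)|=c(i)\binom{n-i}{k-i}$. Then $$e(\mathcal F(P),H)\ge|\mathcal F(P)|-c(i+1)k\binom{n-i-1}{k-i-1}\quad\text{for all }H\in\mathcal F(\bar P),$$ and $$e(\mathcal F(P),\mathcal F(\bar P))\ge\Big(1-\frac{c(i+1)k^2}{c(i)n}\Big)|\mathcal F(P)||\mathcal F(\bar P)|.$$
   Context: For $P\subset[n]$, $\mathcal F(P)=\{F\setminus P:P\subset F\in\mathcal F\}$ and $\mathcal F(\bar P)=\{F\in\mathcal F:F\cap P=\emptyset\}$. For $1\le i\le k$, $c(i)=c(i,\mathcal F)=\binom{n-i}{k-i}^{ -1}\max\{|\mathcal F(P)|:P\in\binom{[n]}{i}\}$. For families $\mathcal G,\mathcal H$ of subsets of $[n]$, $e(\mathcal G,\mathcal H)$ is the number of pairs $(G,H)\in\mathcal G\times\mathcal H$ with $G\cap H=\emptyset$, and $e(\mathcal G,H):=e(\mathcal G,\{H\})$. -}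

module Defs where

open import Data.Bool using (Bool; true; false; _∧_; not)
open import Data.Nat as ℕ using (ℕ; zero; suc; _≡ᵇ_; _⊔_; _∸_)
open import Data.Nat.Combinatorics using (_C_)
open import Data.Fin.Subset using (Subset; _∩_; _∪_; ∣_∣)
open import Data.Vec using ([]; _∷_)
open import Data.List using (List; []; _∷_; map; _++_; filterᵇ; length; foldr)
open import Data.Nat.ListAction using (sum)
open import Relation.Binary.PropositionalEquality using (_≡_)
open import Data.Integer using (+_)
open import Data.Rational as ℚ using (ℚ; 0ℚ; _÷_; _≟_; ≢-nonZero)
open import Relation.Nullary using (yes; no)

Family : ℕ → Set
Family n = Subset n → Bool

allSubsets : ∀ n → List (Subset n)
allSubsets zero = [] ∷ []
allSubsets (suc n) = map (true ∷_) (allSubsets n) ++ map (false ∷_) (allSubsets n)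

size : ∀ {n} → Family n → ℕ
size {n} 𝒢 = length (filterᵇ 𝒢 (allSubsets n))

disjoint : ∀ {n} → Subset n → Subset n → Bool
disjoint A B = ∣ A ∩ B ∣ ≡ᵇ 0

Uniform : ∀ {n} → Family n → ℕ → Set
Uniform 𝒢 k = ∀ A → 𝒢 A ≡ true → ∣ A ∣ ≡ k

-- 𝒢(P) = { F ∖ P : P ⊆ F ∈ 𝒢 } : G belongs iff G ∩ P = ∅ and G ∪ P ∈ 𝒢
link : ∀ {n} → Family n → Subset n → Family n
link 𝒢 P G = disjoint G P ∧ 𝒢 (G ∪ P)

avoid : ∀ {n} → Family n → Subset n → Family n
avoid 𝒢 P F = 𝒢 F ∧ disjoint F P

e₁ : ∀ {n} → Family n → Subset n → ℕ
e₁ 𝒢 H = size (λ G → 𝒢 G ∧ disjoint G H)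

e : ∀ {n} → Family n → Family n → ℕ
e {n} 𝒢 ℋ = sum (map (e₁ 𝒢) (filterᵇ ℋ (allSubsets n)))

maxLink : ∀ {n} → Family n → ℕ → ℕ
maxLink {n} 𝒢 i =
  foldr _⊔_ 0 (map (λ P → size (link 𝒢 P)) (filterᵇ (λ P → ∣ P ∣ ≡ᵇ i) (allSubsets n)))

⟦_⟧ : ℕ → ℚ
⟦ m ⟧ = + m ℚ./ 1

-- c(i, 𝒢) = binom(n-i, k-i)⁻¹ · maxLink 𝒢 i  (for a 𝒢 ⊆ binom([n],k)).
-- The binomial is nonzero whenever i ≤ k ≤ n; the value 0 in the
-- degenerate case is an irrelevant convention.
c : ∀ {n} → ℕ → Family n → ℕ → ℚ
c {n} k 𝒢 i with (n ∸ i) C (k ∸ i)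
... | zero = 0ℚ
... | suc b = + maxLink 𝒢 i ℚ./ suc b

-- division of rationals, with the (irrelevant) convention p / 0 = 0
_/?_ : ℚ → ℚ → ℚ
p /? q with q ≟ 0ℚ
... | yes _ = 0ℚ
... | no q≢0 = _÷_ p q {{≢-nonZero q≢0}}

module Submission where

-- For H ∈ 𝓕(P̄), every member of 𝓕(P) meeting H contains some x ∈ H, and as x ∉ P the map
-- G ↦ G ∖ {x} identifies { G ∈ 𝓕(P) : x ∈ G } with 𝓕(P ∪ {x}), a link of an (i+1)-set, of
-- size at most c(i+1) binom(n-i-1, k-i-1). Since |H| = k this is the first inequality.
-- Summing it over H ∈ 𝓕(P̄) and using n binom(n-i-1, k-i-1) ≤ k binom(n-i, k-i) together with
-- |𝓕(P)| = c(i) binom(n-i, k-i) gives the second.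

open import Defs

module Counting where

  open import Data.Bool using (Bool; true; false; _∧_; _∨_; not; T)
  open import Data.Bool.Properties
    using (∧-comm; ∧-zeroʳ; ∧-identityʳ; ∧-distribˡ-∨; ∧-conicalˡ; ∧-conicalʳ; ∨-inverseʳ; T-≡)
  open import Data.Bool.ListAction using (any; or)
  open import Data.Nat using (ℕ; suc; _+_; _*_; _≤_; z≤n; s≤s; _⊔_; _≡ᵇ_)
  open import Data.Nat.Properties
    using ( ≤-trans; ≤-reflexive; n≤1+n; m≤n⇒m≤1+n; +-suc; +-comm; *-comm; +-mono-≤; +-monoʳ-≤
          ; m≤m⊔n; m≤n⊔m; ≡⇒≡ᵇ; +-commutativeSemigroup; module ≤-Reasoning)
  open import Data.Nat.ListAction using (sum)
  open import Data.Fin using (Fin; zero; suc)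
  open import Data.Fin.Subset using (Subset; _∪_; ∣_∣; ⁅_⁆; ⊥)
  open import Data.Fin.Subset.Properties using (∪-identityʳ; ∪-assoc; ∪-comm)
  open import Data.Vec using ([]; _∷_; lookup)
  open import Data.List using (List; []; _∷_; map; _++_; filterᵇ; length; foldr)
  open import Data.List.Properties using (filter-++; length-++; filter-≐; filter-none; length-map; map-∘)
  open import Data.List.Relation.Unary.All as All using (All; []; _∷_)
  open import Data.List.Relation.Unary.All.Properties using (all-filter; map⁺)
  open import Data.List.Relation.Unary.Any using (here; there)
  open import Data.List.Membership.Propositional using (_∈_)
  open import Data.List.Membership.Propositional.Properties using (∈-++⁺ˡ; ∈-++⁺ʳ; ∈-map⁺; ∈-filter⁺)
  open import Data.Product using (_,_)
  open import Function using (_∘_; Equivalence)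
  open import Relation.Binary.PropositionalEquality
    using (_≡_; refl; sym; trans; cong; cong₂; subst; module ≡-Reasoning)
  open import Relation.Nullary.Decidable using (T?)
  open import Algebra.Properties.CommutativeSemigroup +-commutativeSemigroup using (interchange)

  -- size 𝒢 is definitionally count 𝒢 (allSubsets n).
  count : {A : Set} → (A → Bool) → List A → ℕ
  count p xs = length (filterᵇ p xs)

  module _ {A : Set} where

    count-++ : ∀ (p : A → Bool) xs ys → count p (xs ++ ys) ≡ count p xs + count p ys
    count-++ p xs ys = trans (cong length (filter-++ (T? ∘ p) xs ys)) (length-++ (filterᵇ p xs))

    count-mono : ∀ {p q : A → Bool} xs → (∀ a → p a ≡ true → q a ≡ true) → count p xs ≤ count q xs
    count-mono [] p⇒q = z≤n
    count-mono {p} {q} (x ∷ xs) p⇒q with p x in px | q x in qx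
    ... | true  | true  = s≤s (count-mono xs p⇒q)
    ... | false | true  = m≤n⇒m≤1+n (count-mono xs p⇒q)
    ... | false | false = count-mono xs p⇒q
    ... | true  | false with () ← trans (sym (p⇒q x px)) qx

    count-cong : ∀ {p q : A → Bool} xs → (∀ a → p a ≡ q a) → count p xs ≡ count q xs
    count-cong {p} {q} xs p≡q = cong length (filter-≐ (T? ∘ p) (T? ∘ q)
      ((λ {a} → subst T (p≡q a)) , (λ {a} → subst T (sym (p≡q a)))) xs)

    count-none : ∀ {p : A → Bool} xs → (∀ a → p a ≡ false) → count p xs ≡ 0
    count-none {p} xs p≡false =
      cong length (filter-none (T? ∘ p) {xs} (All.tabulate (λ {a} _ → subst T (p≡false a))))

    count-∨ : ∀ (p q : A → Bool) xs → count (λ a → p a ∨ q a) xs ≤ count p xs + count q xs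
    count-∨ p q [] = z≤n
    count-∨ p q (x ∷ xs) with p x | q x
    ... | true  | true  = s≤s (≤-trans (count-∨ p q xs) (+-monoʳ-≤ (count p xs) (n≤1+n _)))
    ... | true  | false = s≤s (count-∨ p q xs)
    ... | false | true  = ≤-trans (s≤s (count-∨ p q xs)) (≤-reflexive (sym (+-suc _ _)))
    ... | false | false = count-∨ p q xs

    count-any : ∀ {I : Set} (p : A → Bool) (r : I → A → Bool) (is : List I) xs →
      count (λ a → p a ∧ any (λ i → r i a) is) xs ≤ sum (map (λ i → count (λ a → p a ∧ r i a) xs) is)
    count-any p r [] xs = ≤-reflexive (count-none xs (λ a → ∧-zeroʳ (p a)))
    count-any p r (i ∷ is) xs = begin
      count (λ a → p a ∧ (r i a ∨ any (λ j → r j a) is)) xs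
        ≡⟨ count-cong xs (λ a → ∧-distribˡ-∨ (p a) (r i a) _) ⟩
      count (λ a → p a ∧ r i a ∨ p a ∧ any (λ j → r j a) is) xs
        ≤⟨ count-∨ _ _ xs ⟩
      count (λ a → p a ∧ r i a) xs + count (λ a → p a ∧ any (λ j → r j a) is) xs
        ≤⟨ +-monoʳ-≤ _ (count-any p r is xs) ⟩
      count (λ a → p a ∧ r i a) xs + sum (map (λ j → count (λ a → p a ∧ r j a) xs) is) ∎
      where open ≤-Reasoning

  module _ {A B : Set} where

    count-map : ∀ (p : B → Bool) (g : A → B) xs → count p (map g xs) ≡ count (p ∘ g) xs
    count-map p g [] = refl
    count-map p g (x ∷ xs) with p (g x)
    ... | true  = cong suc (count-map p g xs)
    ... | false = count-map p g xs

  module _ {I : Set} where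

    sum-map-≤ : ∀ {g : I → ℕ} {M} {is} → All (λ i → g i ≤ M) is → sum (map g is) ≤ length is * M
    sum-map-≤ [] = z≤n
    sum-map-≤ (gi≤M ∷ gis≤M) = +-mono-≤ gi≤M (sum-map-≤ gis≤M)

    *≤sum-map+* : ∀ {f : I → ℕ} {s t} {is} → All (λ i → s ≤ f i + t) is →
      length is * s ≤ sum (map f is) + length is * t
    *≤sum-map+* [] = z≤n
    *≤sum-map+* {f} {s} {t} {i ∷ is} (s≤fi+t ∷ rest) =
      ≤-trans (+-mono-≤ s≤fi+t (*≤sum-map+* rest)) (≤-reflexive (interchange (f i) t _ _))

  allSubsets-complete : ∀ {n} (A : Subset n) → A ∈ allSubsets n
  allSubsets-complete [] = here refl
  allSubsets-complete {suc n} (true ∷ A) = ∈-++⁺ˡ (∈-map⁺ (true ∷_) (allSubsets-complete A))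
  allSubsets-complete {suc n} (false ∷ A) =
    ∈-++⁺ʳ (map (true ∷_) (allSubsets n)) (∈-map⁺ (false ∷_) (allSubsets-complete A))

  size-∷ : ∀ {n} (𝒢 : Family (suc n)) → size 𝒢 ≡ size (𝒢 ∘ (true ∷_)) + size (𝒢 ∘ (false ∷_))
  size-∷ {n} 𝒢 = trans (count-++ 𝒢 (map (true ∷_) (allSubsets n)) (map (false ∷_) (allSubsets n)))
    (cong₂ _+_ (count-map 𝒢 (true ∷_) (allSubsets n)) (count-map 𝒢 (false ∷_) (allSubsets n)))

  size-∋≡size-∪⁅⁆ : ∀ {n} (𝒢 : Family n) (x : Fin n) →
    size (λ G → 𝒢 G ∧ lookup G x) ≡ size (λ G → 𝒢 (G ∪ ⁅ x ⁆) ∧ not (lookup G x))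
  size-∋≡size-∪⁅⁆ {suc n} 𝒢 zero = begin
    size (λ G → 𝒢 G ∧ lookup G zero)
      ≡⟨ size-∷ {n} _ ⟩
    size (λ G → 𝒢 (true ∷ G) ∧ true) + size (λ G → 𝒢 (false ∷ G) ∧ false)
      ≡⟨ cong₂ _+_ (count-cong (allSubsets n) 𝒢[G∪⊥]) (size-∧false (𝒢 ∘ (false ∷_))) ⟩
    X + 0
      ≡⟨ +-comm X 0 ⟩
    0 + X
      ≡⟨ cong (_+ X) (size-∧false (λ G → 𝒢 (true ∷ (G ∪ ⊥)))) ⟨
    size (λ G → 𝒢 (true ∷ (G ∪ ⊥)) ∧ false) + X
      ≡⟨ size-∷ {n} _ ⟨
    size (λ G → 𝒢 (G ∪ ⁅ zero ⁆) ∧ not (lookup G zero)) ∎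
    where
    open ≡-Reasoning
    X = size (λ G → 𝒢 (true ∷ (G ∪ ⊥)) ∧ true)
    𝒢[G∪⊥] : ∀ G → 𝒢 (true ∷ G) ∧ true ≡ 𝒢 (true ∷ (G ∪ ⊥)) ∧ true
    𝒢[G∪⊥] G = cong (λ A → 𝒢 (true ∷ A) ∧ true) (sym (∪-identityʳ G))
    size-∧false : ∀ (ℋ : Family n) → size (λ G → ℋ G ∧ false) ≡ 0
    size-∧false ℋ = count-none (allSubsets n) (λ G → ∧-zeroʳ (ℋ G))
  size-∋≡size-∪⁅⁆ {suc n} 𝒢 (suc y) = begin
    size (λ G → 𝒢 G ∧ lookup G (suc y))
      ≡⟨ size-∷ {n} _ ⟩
    size (λ G → 𝒢 (true ∷ G) ∧ lookup G y) + size (λ G → 𝒢 (false ∷ G) ∧ lookup G y)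
      ≡⟨ cong₂ _+_ (size-∋≡size-∪⁅⁆ (𝒢 ∘ (true ∷_)) y) (size-∋≡size-∪⁅⁆ (𝒢 ∘ (false ∷_)) y) ⟩
    size (λ G → 𝒢 (true ∷ (G ∪ ⁅ y ⁆)) ∧ not (lookup G y))
      + size (λ G → 𝒢 (false ∷ (G ∪ ⁅ y ⁆)) ∧ not (lookup G y))
      ≡⟨ size-∷ {n} _ ⟨
    size (λ G → 𝒢 (G ∪ ⁅ suc y ⁆) ∧ not (lookup G (suc y))) ∎
    where open ≡-Reasoning

  disjoint-∷ : ∀ {n} a b (A B : Subset n) → disjoint (a ∷ A) (b ∷ B) ≡ not (a ∧ b) ∧ disjoint A B
  disjoint-∷ true  true  A B = refl
  disjoint-∷ true  false A B = refl
  disjoint-∷ false true  A B = refl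
  disjoint-∷ false false A B = refl

  disjoint-comm : ∀ {n} (A B : Subset n) → disjoint A B ≡ disjoint B A
  disjoint-comm [] [] = refl
  disjoint-comm (a ∷ A) (b ∷ B) = begin
    disjoint (a ∷ A) (b ∷ B)  ≡⟨ disjoint-∷ a b A B ⟩
    not (a ∧ b) ∧ disjoint A B ≡⟨ cong₂ (λ c d → not c ∧ d) (∧-comm a b) (disjoint-comm A B) ⟩
    not (b ∧ a) ∧ disjoint B A ≡⟨ disjoint-∷ b a B A ⟨
    disjoint (b ∷ B) (a ∷ A)  ∎
    where open ≡-Reasoning

  disjoint-∪ˡ : ∀ {n} (A B C : Subset n) → disjoint (A ∪ B) C ≡ disjoint A C ∧ disjoint B C
  disjoint-∪ˡ [] [] [] = refl
  disjoint-∪ˡ (a ∷ A) (b ∷ B) (c ∷ C) = begin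
    disjoint ((a ∨ b) ∷ (A ∪ B)) (c ∷ C)
      ≡⟨ disjoint-∷ (a ∨ b) c (A ∪ B) C ⟩
    not ((a ∨ b) ∧ c) ∧ disjoint (A ∪ B) C
      ≡⟨ cong (not ((a ∨ b) ∧ c) ∧_) (disjoint-∪ˡ A B C) ⟩
    not ((a ∨ b) ∧ c) ∧ (disjoint A C ∧ disjoint B C)
      ≡⟨ distrib a b c (disjoint A C) (disjoint B C) ⟩
    (not (a ∧ c) ∧ disjoint A C) ∧ (not (b ∧ c) ∧ disjoint B C)
      ≡⟨ cong₂ _∧_ (disjoint-∷ a c A C) (disjoint-∷ b c B C) ⟨
    disjoint (a ∷ A) (c ∷ C) ∧ disjoint (b ∷ B) (c ∷ C) ∎
    where
    open ≡-Reasoning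
    distrib : ∀ a b c x y → not ((a ∨ b) ∧ c) ∧ (x ∧ y) ≡ (not (a ∧ c) ∧ x) ∧ (not (b ∧ c) ∧ y)
    distrib true  _     true  x y = refl
    distrib false true  true  x y = sym (∧-zeroʳ x)
    distrib false false true  x y = refl
    distrib true  true  false x y = refl
    distrib true  false false x y = refl
    distrib false true  false x y = refl
    distrib false false false x y = refl

  disjoint-⊥ : ∀ {n} (A : Subset n) → disjoint A ⊥ ≡ true
  disjoint-⊥ [] = refl
  disjoint-⊥ (true ∷ A) = disjoint-⊥ A
  disjoint-⊥ (false ∷ A) = disjoint-⊥ A

  disjoint-⁅⁆ : ∀ {n} (A : Subset n) x → disjoint A ⁅ x ⁆ ≡ not (lookup A x)
  disjoint-⁅⁆ (true ∷ A) zero = refl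
  disjoint-⁅⁆ (false ∷ A) zero = disjoint-⊥ A
  disjoint-⁅⁆ (true ∷ A) (suc y) = disjoint-⁅⁆ A y
  disjoint-⁅⁆ (false ∷ A) (suc y) = disjoint-⁅⁆ A y

  link-∪⁅⁆ : ∀ {n} (𝒢 : Family n) (P G : Subset n) (x : Fin n) → lookup P x ≡ false →
    link 𝒢 P (G ∪ ⁅ x ⁆) ∧ not (lookup G x) ≡ link 𝒢 (P ∪ ⁅ x ⁆) G
  link-∪⁅⁆ 𝒢 P G x x∉P = begin
    (disjoint (G ∪ ⁅ x ⁆) P ∧ 𝒢 ((G ∪ ⁅ x ⁆) ∪ P)) ∧ not (lookup G x)
      ≡⟨ cong (λ d → (d ∧ 𝒢 ((G ∪ ⁅ x ⁆) ∪ P)) ∧ not (lookup G x)) (disjoint-∪ˡ G ⁅ x ⁆ P) ⟩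
    ((disjoint G P ∧ disjoint ⁅ x ⁆ P) ∧ 𝒢 ((G ∪ ⁅ x ⁆) ∪ P)) ∧ not (lookup G x)
      ≡⟨ cong (λ d → ((disjoint G P ∧ d) ∧ 𝒢 ((G ∪ ⁅ x ⁆) ∪ P)) ∧ not (lookup G x)) ⁅x⁆∩P=∅ ⟩
    ((disjoint G P ∧ true) ∧ 𝒢 ((G ∪ ⁅ x ⁆) ∪ P)) ∧ not (lookup G x)
      ≡⟨ swap (disjoint G P) _ _ ⟩
    (disjoint G P ∧ not (lookup G x)) ∧ 𝒢 ((G ∪ ⁅ x ⁆) ∪ P)
      ≡⟨ cong₂ _∧_ G∩[P∪⁅x⁆] (cong 𝒢 G∪[P∪⁅x⁆]) ⟨
    disjoint G (P ∪ ⁅ x ⁆) ∧ 𝒢 (G ∪ (P ∪ ⁅ x ⁆)) ∎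
    where
    open ≡-Reasoning
    ⁅x⁆∩P=∅ : disjoint ⁅ x ⁆ P ≡ true
    ⁅x⁆∩P=∅ = trans (disjoint-comm ⁅ x ⁆ P) (trans (disjoint-⁅⁆ P x) (cong not x∉P))
    G∩[P∪⁅x⁆] : disjoint G (P ∪ ⁅ x ⁆) ≡ disjoint G P ∧ not (lookup G x)
    G∩[P∪⁅x⁆] = begin
      disjoint G (P ∪ ⁅ x ⁆)                 ≡⟨ disjoint-comm G _ ⟩
      disjoint (P ∪ ⁅ x ⁆) G                 ≡⟨ disjoint-∪ˡ P ⁅ x ⁆ G ⟩
      disjoint P G ∧ disjoint ⁅ x ⁆ G        ≡⟨ cong₂ _∧_ (disjoint-comm P G) (disjoint-comm ⁅ x ⁆ G) ⟩
      disjoint G P ∧ disjoint G ⁅ x ⁆        ≡⟨ cong (disjoint G P ∧_) (disjoint-⁅⁆ G x) ⟩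
      disjoint G P ∧ not (lookup G x)        ∎
    G∪[P∪⁅x⁆] : G ∪ (P ∪ ⁅ x ⁆) ≡ (G ∪ ⁅ x ⁆) ∪ P
    G∪[P∪⁅x⁆] = trans (cong (G ∪_) (∪-comm P ⁅ x ⁆)) (sym (∪-assoc G ⁅ x ⁆ P))
    swap : ∀ a b c → ((a ∧ true) ∧ b) ∧ c ≡ (a ∧ c) ∧ b
    swap true  b c = ∧-comm b c
    swap false b c = refl

  size-link-∋ : ∀ {n} (𝒢 : Family n) (P : Subset n) (x : Fin n) → lookup P x ≡ false →
    size (λ G → link 𝒢 P G ∧ lookup G x) ≡ size (link 𝒢 (P ∪ ⁅ x ⁆))
  size-link-∋ {n} 𝒢 P x x∉P = trans (size-∋≡size-∪⁅⁆ (link 𝒢 P) x)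
    (count-cong (allSubsets n) (λ G → link-∪⁅⁆ 𝒢 P G x x∉P))

  ∣P∪⁅x⁆∣≡1+∣P∣ : ∀ {n} (P : Subset n) (x : Fin n) → lookup P x ≡ false → ∣ P ∪ ⁅ x ⁆ ∣ ≡ suc ∣ P ∣
  ∣P∪⁅x⁆∣≡1+∣P∣ (false ∷ P) zero x∉P = cong suc (cong ∣_∣ (∪-identityʳ P))
  ∣P∪⁅x⁆∣≡1+∣P∣ (true ∷ P) (suc y) x∉P = cong suc (∣P∪⁅x⁆∣≡1+∣P∣ P y x∉P)
  ∣P∪⁅x⁆∣≡1+∣P∣ (false ∷ P) (suc y) x∉P = ∣P∪⁅x⁆∣≡1+∣P∣ P y x∉P

  elements : ∀ {n} → Subset n → List (Fin n)
  elements [] = []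
  elements (true ∷ A) = zero ∷ map suc (elements A)
  elements (false ∷ A) = map suc (elements A)

  length-elements : ∀ {n} (A : Subset n) → length (elements A) ≡ ∣ A ∣
  length-elements [] = refl
  length-elements (true ∷ A) = cong suc (trans (length-map suc (elements A)) (length-elements A))
  length-elements (false ∷ A) = trans (length-map suc (elements A)) (length-elements A)

  elements-∈ : ∀ {n} (A : Subset n) → All (λ x → lookup A x ≡ true) (elements A)
  elements-∈ [] = []
  elements-∈ (true ∷ A) = refl ∷ map⁺ (elements-∈ A)
  elements-∈ (false ∷ A) = map⁺ (elements-∈ A)

  any-elements : ∀ {n} (G A : Subset n) → any (lookup G) (elements A) ≡ not (disjoint G A)
  any-elements [] [] = refl
  any-elements (g ∷ G) (a ∷ A) = begin
    any (lookup (g ∷ G)) (elements (a ∷ A))     ≡⟨ any-elements-∷ a ⟩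
    g ∧ a ∨ any (lookup G) (elements A)          ≡⟨ cong (g ∧ a ∨_) (any-elements G A) ⟩
    g ∧ a ∨ not (disjoint G A)                   ≡⟨ de-morgan (g ∧ a) (disjoint G A) ⟩
    not (not (g ∧ a) ∧ disjoint G A)             ≡⟨ cong not (disjoint-∷ g a G A) ⟨
    not (disjoint (g ∷ G) (a ∷ A))               ∎
    where
    open ≡-Reasoning
    any-suc : ∀ xs → any (lookup (g ∷ G)) (map suc xs) ≡ any (lookup G) xs
    any-suc xs = cong or (sym (map-∘ xs))
    any-elements-∷ : ∀ a → any (lookup (g ∷ G)) (elements (a ∷ A)) ≡ g ∧ a ∨ any (lookup G) (elements A)
    any-elements-∷ true  = trans (cong (g ∨_) (any-suc (elements A))) (cong (_∨ _) (sym (∧-identityʳ g)))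
    any-elements-∷ false = trans (any-suc (elements A)) (cong (_∨ _) (sym (∧-zeroʳ g)))
    de-morgan : ∀ a b → a ∨ not b ≡ not (not a ∧ b)
    de-morgan true  b = refl
    de-morgan false b = refl

  disjoint⇒∉ : ∀ {n} (A B : Subset n) x →
    disjoint A B ≡ true → lookup A x ≡ true → lookup B x ≡ false
  disjoint⇒∉ (true ∷ A) (false ∷ B) zero A∩B=∅ x∈A = refl
  disjoint⇒∉ (a ∷ A) (b ∷ B) (suc y) A∩B=∅ x∈A =
    disjoint⇒∉ A B y (∧-conicalʳ _ _ (trans (sym (disjoint-∷ a b A B)) A∩B=∅)) x∈A

  size≤e₁+size-meeting : ∀ {n} (𝒢 : Family n) H →
    size 𝒢 ≤ e₁ 𝒢 H + size (λ G → 𝒢 G ∧ not (disjoint G H))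
  size≤e₁+size-meeting {n} 𝒢 H =
    ≤-trans (count-mono (allSubsets n) split) (count-∨ _ _ (allSubsets n))
    where
    split : ∀ G → 𝒢 G ≡ true → 𝒢 G ∧ disjoint G H ∨ 𝒢 G ∧ not (disjoint G H) ≡ true
    split G G∈𝒢 rewrite G∈𝒢 = ∨-inverseʳ (disjoint G H)

  size-meeting≤∣H∣*M : ∀ {n} (𝒢 : Family n) (H : Subset n) M →
    (∀ x → lookup H x ≡ true → size (λ G → 𝒢 G ∧ lookup G x) ≤ M) →
    size (λ G → 𝒢 G ∧ not (disjoint G H)) ≤ ∣ H ∣ * M
  size-meeting≤∣H∣*M {n} 𝒢 H M bound = begin
    size (λ G → 𝒢 G ∧ not (disjoint G H))
      ≡⟨ count-cong (allSubsets n) (λ G → cong (𝒢 G ∧_) (sym (any-elements G H))) ⟩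
    size (λ G → 𝒢 G ∧ any (lookup G) (elements H))
      ≤⟨ count-any 𝒢 (λ x G → lookup G x) (elements H) (allSubsets n) ⟩
    sum (map (λ x → size (λ G → 𝒢 G ∧ lookup G x)) (elements H))
      ≤⟨ sum-map-≤ (All.map (bound _) (elements-∈ H)) ⟩
    length (elements H) * M
      ≡⟨ cong (_* M) (length-elements H) ⟩
    ∣ H ∣ * M ∎
    where open ≤-Reasoning

  ∈⇒≤foldr-⊔ : ∀ {m ms} → m ∈ ms → m ≤ foldr _⊔_ 0 ms
  ∈⇒≤foldr-⊔ {ms = m ∷ ms} (here refl) = m≤m⊔n m _
  ∈⇒≤foldr-⊔ {ms = m′ ∷ ms} (there m∈ms) = ≤-trans (∈⇒≤foldr-⊔ m∈ms) (m≤n⊔m m′ _)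

  size-link≤maxLink : ∀ {n} (𝒢 : Family n) (Q : Subset n) {j} →
    ∣ Q ∣ ≡ j → size (link 𝒢 Q) ≤ maxLink 𝒢 j
  size-link≤maxLink {n} 𝒢 Q {j} ∣Q∣≡j = ∈⇒≤foldr-⊔ (∈-map⁺ (λ P → size (link 𝒢 P))
    (∈-filter⁺ (T? ∘ λ P → ∣ P ∣ ≡ᵇ j) (allSubsets-complete Q) (≡⇒≡ᵇ _ _ ∣Q∣≡j)))

  size-link≤e₁+k*maxLink : ∀ {n k} (𝓕 : Family n) → Uniform 𝓕 k →
    ∀ {i} (P : Subset n) → ∣ P ∣ ≡ i →
    ∀ H → avoid 𝓕 P H ≡ true → size (link 𝓕 P) ≤ e₁ (link 𝓕 P) H + k * maxLink 𝓕 (i + 1)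
  size-link≤e₁+k*maxLink {k = k} 𝓕 uniform {i} P ∣P∣≡i H H∈𝓕[P̄] =
    ≤-trans (size≤e₁+size-meeting (link 𝓕 P) H)
      (+-monoʳ-≤ _ (subst (λ h → _ ≤ h * maxLink 𝓕 (i + 1)) ∣H∣≡k
        (size-meeting≤∣H∣*M (link 𝓕 P) H _ link-∋≤maxLink)))
    where
    ∣H∣≡k : ∣ H ∣ ≡ k
    ∣H∣≡k = uniform H (∧-conicalˡ _ _ H∈𝓕[P̄])
    link-∋≤maxLink : ∀ x → lookup H x ≡ true →
      size (λ G → link 𝓕 P G ∧ lookup G x) ≤ maxLink 𝓕 (i + 1)
    link-∋≤maxLink x x∈H = begin
      size (λ G → link 𝓕 P G ∧ lookup G x) ≡⟨ size-link-∋ 𝓕 P x x∉P ⟩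
      size (link 𝓕 (P ∪ ⁅ x ⁆))             ≤⟨ size-link≤maxLink 𝓕 (P ∪ ⁅ x ⁆) ∣P∪⁅x⁆∣≡i+1 ⟩
      maxLink 𝓕 (i + 1)                     ∎
      where
      open ≤-Reasoning
      x∉P : lookup P x ≡ false
      x∉P = disjoint⇒∉ H P x (∧-conicalʳ _ _ H∈𝓕[P̄]) x∈H
      ∣P∪⁅x⁆∣≡i+1 : ∣ P ∪ ⁅ x ⁆ ∣ ≡ i + 1
      ∣P∪⁅x⁆∣≡i+1 = trans (∣P∪⁅x⁆∣≡1+∣P∣ P x x∉P) (trans (cong suc ∣P∣≡i) (+-comm 1 i))

  size-link*size-avoid≤e+size-avoid*k*maxLink : ∀ {n k} (𝓕 : Family n) → Uniform 𝓕 k →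
    ∀ {i} (P : Subset n) → ∣ P ∣ ≡ i →
    size (link 𝓕 P) * size (avoid 𝓕 P)
      ≤ e (link 𝓕 P) (avoid 𝓕 P) + size (avoid 𝓕 P) * (k * maxLink 𝓕 (i + 1))
  size-link*size-avoid≤e+size-avoid*k*maxLink {n} 𝓕 uniform P ∣P∣≡i =
    ≤-trans (≤-reflexive (*-comm (size (link 𝓕 P)) (size (avoid 𝓕 P))))
      (*≤sum-map+* (All.map (size-link≤e₁+k*maxLink 𝓕 uniform P ∣P∣≡i _ ∘ Equivalence.to T-≡)
        (all-filter (T? ∘ avoid 𝓕 P) (allSubsets n))))

module Binomial where

  open import Data.Nat using (suc; _+_; _*_; _∸_; _≤_; _<_; s≤s; _!; ≢-nonZero⁻¹)
  open import Data.Nat.Properties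
    using ( *-assoc; *-comm; +-suc; *-distribˡ-+; *-distribʳ-+; +-monoˡ-≤; *-monoˡ-≤; *-cancelˡ-≤
          ; *-cancelʳ-≡; ≤-pred; +-cancelˡ-≤; <-≤-trans; m+n∸m≡n; n≢0⇒n>0; m≤n⇒∃[o]m+o≡n
          ; _!≢0; _!*_!≢0; *-commutativeSemigroup; module ≤-Reasoning)
  open import Data.Nat.Combinatorics using (_C_; nCk≡n!/k![n-k]!; k![n∸k]!∣n!)
  open import Data.Nat.DivMod using (m/n*n≡m)
  open import Data.Nat.Tactic.RingSolver using (solve-∀)
  open import Data.Product using (∃; _,_)
  open import Relation.Binary.PropositionalEquality
    using (_≡_; refl; sym; trans; cong; module ≡-Reasoning)
  open import Algebra.Properties.CommutativeSemigroup *-commutativeSemigroup using (x∙yz≈y∙xz)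

  nCk*k![n∸k]!≡n! : ∀ {n k} → k ≤ n → (n C k) * (k ! * (n ∸ k) !) ≡ n !
  nCk*k![n∸k]!≡n! {n} {k} k≤n = trans (cong (_* (k ! * (n ∸ k) !)) (nCk≡n!/k![n-k]! k≤n))
    (m/n*n≡m (k![n∸k]!∣n! k≤n))
    where instance _ = k !* (n ∸ k) !≢0

  nCk>0 : ∀ {n k} → k ≤ n → 0 < n C k
  nCk>0 {n} {k} k≤n = n≢0⇒n>0 λ nCk≡0 → ≢-nonZero⁻¹ (n !) {{n !≢0}}
    (trans (sym (nCk*k![n∸k]!≡n! k≤n)) (cong (_* (k ! * (n ∸ k) !)) nCk≡0))

  [k+1]*[n+1]C[k+1]≡[n+1]*nCk : ∀ {n k} → k ≤ n → suc k * (suc n C suc k) ≡ suc n * (n C k)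
  [k+1]*[n+1]C[k+1]≡[n+1]*nCk {n} {k} k≤n = *-cancelʳ-≡ _ _ (k ! * (n ∸ k) !) {{k !* (n ∸ k) !≢0}} (begin
    suc k * (suc n C suc k) * (k ! * (n ∸ k) !) ≡⟨ reassoc (suc k) (suc n C suc k) (k !) ((n ∸ k) !) ⟩
    (suc n C suc k) * (suc k ! * (n ∸ k) !)      ≡⟨ nCk*k![n∸k]!≡n! (s≤s k≤n) ⟩
    suc n !                                      ≡⟨ cong (suc n *_) (nCk*k![n∸k]!≡n! k≤n) ⟨
    suc n * ((n C k) * (k ! * (n ∸ k) !))        ≡⟨ *-assoc (suc n) (n C k) _ ⟨
    suc n * (n C k) * (k ! * (n ∸ k) !)          ∎)
    where
    open ≡-Reasoning
    reassoc : ∀ a b c d → a * b * (c * d) ≡ b * (a * c * d)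
    reassoc = solve-∀

  [i+1+m]*mCa≤[i+1+a]*[m+1]C[a+1] : ∀ i {m a} → a ≤ m →
    (i + suc m) * (m C a) ≤ (i + suc a) * (suc m C suc a)
  [i+1+m]*mCa≤[i+1+a]*[m+1]C[a+1] i {m} {a} a≤m = *-cancelˡ-≤ (suc a) (begin
    suc a * ((i + suc m) * (m C a))         ≡⟨ *-assoc (suc a) (i + suc m) _ ⟨
    suc a * (i + suc m) * (m C a)           ≤⟨ *-monoˡ-≤ (m C a) ratio ⟩
    (i + suc a) * suc m * (m C a)           ≡⟨ *-assoc (i + suc a) (suc m) _ ⟩
    (i + suc a) * (suc m * (m C a))         ≡⟨ cong ((i + suc a) *_) ([k+1]*[n+1]C[k+1]≡[n+1]*nCk a≤m) ⟨
    (i + suc a) * (suc a * (suc m C suc a)) ≡⟨ x∙yz≈y∙xz (i + suc a) (suc a) _ ⟩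
    suc a * ((i + suc a) * (suc m C suc a)) ∎)
    where
    open ≤-Reasoning
    ratio : suc a * (i + suc m) ≤ (i + suc a) * suc m
    ratio = begin
      suc a * (i + suc m)       ≡⟨ *-distribˡ-+ (suc a) i (suc m) ⟩
      suc a * i + suc a * suc m ≤⟨ +-monoˡ-≤ (suc a * suc m) (*-monoˡ-≤ i (s≤s a≤m)) ⟩
      suc m * i + suc a * suc m ≡⟨ cong (_+ suc a * suc m) (*-comm (suc m) i) ⟩
      i * suc m + suc a * suc m ≡⟨ *-distribʳ-+ (suc m) i (suc a) ⟨
      (i + suc a) * suc m       ∎

  <⇒∃[a]≡+suc : ∀ {i k} → i < k → ∃ λ a → k ≡ i + suc a
  <⇒∃[a]≡+suc {i} i<k with a , refl ← m≤n⇒∃[o]m+o≡n i<k = a , sym (+-suc i a)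

  n*[n∸i∸1]C[k∸i∸1]≤k*[n∸i]C[k∸i] : ∀ {n k i} → i < k → k ≤ n →
    n * ((n ∸ i ∸ 1) C (k ∸ i ∸ 1)) ≤ k * ((n ∸ i) C (k ∸ i))
  n*[n∸i∸1]C[k∸i∸1]≤k*[n∸i]C[k∸i] {i = i} i<k k≤n
    with a , refl ← <⇒∃[a]≡+suc i<k | m , refl ← <⇒∃[a]≡+suc (<-≤-trans i<k k≤n)
    rewrite m+n∸m≡n i (suc m) | m+n∸m≡n i (suc a) =
    [i+1+m]*mCa≤[i+1+a]*[m+1]C[a+1] i (≤-pred (+-cancelˡ-≤ i _ _ k≤n))

module Rational where

  open import Data.Nat as ℕ using (zero; suc)
  import Data.Nat.Properties as ℕ
  open import Data.Nat.Combinatorics using (_C_)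
  open import Data.Integer as ℤ using (+_)
  import Data.Integer.Properties as ℤ
  open import Data.Rational
  open import Data.Rational.Properties
  open import Data.Rational.Unnormalised as ℚᵘ using (mkℚᵘ; *≡*; *≤*) renaming (_≃_ to _≃ᵘ_)
  import Data.Rational.Unnormalised.Properties as ℚᵘ
  open import Data.List using ([]; _∷_)
  open import Function using (_∘_)
  open import Relation.Binary.PropositionalEquality
    using (_≡_; _≢_; refl; sym; trans; cong; cong₂; subst₂; module ≡-Reasoning)
  open import Relation.Nullary using (Dec; yes; no; contradiction)
  open import Relation.Nullary.Decidable using (dec⇒maybe)
  open import Tactic.RingSolver using (solve-∀; solve)
  import Tactic.RingSolver.Core.AlmostCommutativeRing as ACR

  ℚ-ring : ACR.AlmostCommutativeRing _ _
  ℚ-ring = ACR.fromCommutativeRing +-*-commutativeRing (dec⇒maybe ∘ (0ℚ ≟_))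

  toℚᵘ⟦⟧ : ∀ m → toℚᵘ ⟦ m ⟧ ≃ᵘ mkℚᵘ (+ m) 0
  toℚᵘ⟦⟧ m = toℚᵘ-fromℚᵘ (mkℚᵘ (+ m) 0)

  ⟦⟧-homo-+ : ∀ a b → ⟦ a ℕ.+ b ⟧ ≡ ⟦ a ⟧ + ⟦ b ⟧
  ⟦⟧-homo-+ a b = toℚᵘ-injective (begin
    toℚᵘ ⟦ a ℕ.+ b ⟧                  ≈⟨ toℚᵘ⟦⟧ (a ℕ.+ b) ⟩
    mkℚᵘ (+ (a ℕ.+ b)) 0              ≈⟨ *≡* (cong (ℤ._* + 1) (trans (ℤ.pos-+ a b)
                                          (sym (cong₂ ℤ._+_ (ℤ.*-identityʳ (+ a)) (ℤ.*-identityʳ (+ b)))))) ⟩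
    mkℚᵘ (+ a) 0 ℚᵘ.+ mkℚᵘ (+ b) 0    ≈⟨ ℚᵘ.+-cong (toℚᵘ⟦⟧ a) (toℚᵘ⟦⟧ b) ⟨
    toℚᵘ ⟦ a ⟧ ℚᵘ.+ toℚᵘ ⟦ b ⟧         ≈⟨ toℚᵘ-homo-+ ⟦ a ⟧ ⟦ b ⟧ ⟨
    toℚᵘ (⟦ a ⟧ + ⟦ b ⟧)               ∎)
    where open ℚᵘ.≃-Reasoning

  ⟦⟧-homo-* : ∀ a b → ⟦ a ℕ.* b ⟧ ≡ ⟦ a ⟧ * ⟦ b ⟧
  ⟦⟧-homo-* a b = toℚᵘ-injective (begin
    toℚᵘ ⟦ a ℕ.* b ⟧                  ≈⟨ toℚᵘ⟦⟧ (a ℕ.* b) ⟩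
    mkℚᵘ (+ (a ℕ.* b)) 0              ≈⟨ *≡* (cong (ℤ._* + 1) (ℤ.pos-* a b)) ⟩
    mkℚᵘ (+ a) 0 ℚᵘ.* mkℚᵘ (+ b) 0    ≈⟨ ℚᵘ.*-cong (toℚᵘ⟦⟧ a) (toℚᵘ⟦⟧ b) ⟨
    toℚᵘ ⟦ a ⟧ ℚᵘ.* toℚᵘ ⟦ b ⟧         ≈⟨ toℚᵘ-homo-* ⟦ a ⟧ ⟦ b ⟧ ⟨
    toℚᵘ (⟦ a ⟧ * ⟦ b ⟧)               ∎)
    where open ℚᵘ.≃-Reasoning

  ⟦⟧-mono-≤ : ∀ {a b} → a ℕ.≤ b → ⟦ a ⟧ ≤ ⟦ b ⟧
  ⟦⟧-mono-≤ {a} {b} a≤b = toℚᵘ-cancel-≤ (begin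
    toℚᵘ ⟦ a ⟧     ≃⟨ toℚᵘ⟦⟧ a ⟩
    mkℚᵘ (+ a) 0   ≤⟨ *≤* (ℤ.*-monoʳ-≤-nonNeg (+ 1) (ℤ.+≤+ a≤b)) ⟩
    mkℚᵘ (+ b) 0   ≃⟨ toℚᵘ⟦⟧ b ⟨
    toℚᵘ ⟦ b ⟧     ∎)
    where open ℚᵘ.≤-Reasoning

  ⟦⟧-nonNeg : ∀ m → NonNegative ⟦ m ⟧
  ⟦⟧-nonNeg m = normalize-nonNeg m 1

  ⟦⟧-pos : ∀ m .{{_ : ℕ.NonZero m}} → Positive ⟦ m ⟧
  ⟦⟧-pos m = normalize-pos m 1

  +m/n*⟦n⟧≡⟦m⟧ : ∀ m n .{{_ : ℕ.NonZero n}} → (+ m / n) * ⟦ n ⟧ ≡ ⟦ m ⟧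
  +m/n*⟦n⟧≡⟦m⟧ m n@(suc n-1) = toℚᵘ-injective (begin
    toℚᵘ ((+ m / n) * ⟦ n ⟧)                 ≈⟨ toℚᵘ-homo-* (+ m / n) ⟦ n ⟧ ⟩
    toℚᵘ (+ m / n) ℚᵘ.* toℚᵘ ⟦ n ⟧           ≈⟨ ℚᵘ.*-cong (toℚᵘ-fromℚᵘ (mkℚᵘ (+ m) n-1)) (toℚᵘ⟦⟧ n) ⟩
    mkℚᵘ (+ m) n-1 ℚᵘ.* mkℚᵘ (+ n) 0         ≈⟨ *≡* (trans (ℤ.*-identityʳ _)
                                                   (cong (λ d → + m ℤ.* + suc d) (sym (ℕ.*-identityʳ n-1)))) ⟩
    mkℚᵘ (+ m) 0                             ≈⟨ toℚᵘ⟦⟧ m ⟨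
    toℚᵘ ⟦ m ⟧                               ∎)
    where open ℚᵘ.≃-Reasoning

  c*C≡maxLink : ∀ {n} k (𝒢 : Family n) j → 0 ℕ.< (n ℕ.∸ j) C (k ℕ.∸ j) →
    c k 𝒢 j * ⟦ (n ℕ.∸ j) C (k ℕ.∸ j) ⟧ ≡ ⟦ maxLink 𝒢 j ⟧
  c*C≡maxLink {n} k 𝒢 j C>0 with (n ℕ.∸ j) C (k ℕ.∸ j)
  ... | suc b = +m/n*⟦n⟧≡⟦m⟧ (maxLink 𝒢 j) (suc b)

  c≥0 : ∀ {n} k (𝒢 : Family n) j → 0ℚ ≤ c k 𝒢 j
  c≥0 {n} k 𝒢 j with (n ℕ.∸ j) C (k ℕ.∸ j)
  ... | zero = ≤-refl
  ... | suc b = nonNegative⁻¹ _ {{normalize-nonNeg (maxLink 𝒢 j) (suc b)}}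

  p≤q+r⇒p-r≤q : ∀ {p q r} → p ≤ q + r → p - r ≤ q
  p≤q+r⇒p-r≤q {p} {q} {r} p≤q+r = begin
    p - r     ≤⟨ +-monoˡ-≤ (- r) p≤q+r ⟩
    q + r - r ≡⟨ solve (q ∷ r ∷ []) ℚ-ring ⟩
    q         ∎
    where open ≤-Reasoning

  p/?q*q≡p : ∀ p q → q ≢ 0ℚ → (p /? q) * q ≡ p
  p/?q*q≡p p q q≢0 with q ≟ 0ℚ
  ... | yes q≡0 = contradiction q≡0 q≢0
  ... | no  q≢0′ = begin
    p * 1/ q * q   ≡⟨ *-assoc p (1/ q) q ⟩
    p * (1/ q * q) ≡⟨ cong (p *_) (*-inverseˡ q) ⟩
    p * 1ℚ         ≡⟨ *-identityʳ p ⟩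
    p              ∎
    where
    open ≡-Reasoning
    instance _ = ≢-nonZero q≢0′

  p*q≡0⇒p≡0 : ∀ p q .{{_ : NonZero q}} → p * q ≡ 0ℚ → p ≡ 0ℚ
  p*q≡0⇒p≡0 p q pq≡0 = begin
    p              ≡⟨ *-identityʳ p ⟨
    p * 1ℚ         ≡⟨ cong (p *_) (*-inverseʳ q) ⟨
    p * (q * 1/ q) ≡⟨ *-assoc p q (1/ q) ⟨
    p * q * 1/ q   ≡⟨ cong (_* 1/ q) pq≡0 ⟩
    0ℚ * 1/ q      ≡⟨ *-zeroˡ (1/ q) ⟩
    0ℚ             ∎
    where open ≡-Reasoning

  [1-q]*L*A≤E : ∀ {q L A E d} .{{_ : NonNegative A}} →
    L * A ≤ E + A * d → d ≤ q * L → (1ℚ - q) * L * A ≤ E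
  [1-q]*L*A≤E {q} {L} {A} {E} {d} LA≤E+Ad d≤qL = begin
    (1ℚ - q) * L * A    ≡⟨ solve (q ∷ L ∷ A ∷ []) ℚ-ring ⟩
    L * A - A * (q * L) ≤⟨ +-monoʳ-≤ (L * A) (neg-antimono-≤ (*-monoˡ-≤-nonNeg A d≤qL)) ⟩
    L * A - A * d       ≤⟨ p≤q+r⇒p-r≤q LA≤E+Ad ⟩
    E                   ∎
    where open ≤-Reasoning

  k*[c₁*C₁]≤q*[c₀*C₀] : ∀ {c₀ c₁ k n C₀ C₁} →
    .{{_ : NonNegative c₁}} .{{_ : NonNegative k}} .{{_ : Positive n}} →
    c₀ * n ≢ 0ℚ → n * C₁ ≤ k * C₀ → k * (c₁ * C₁) ≤ ((c₁ * (k * k)) /? (c₀ * n)) * (c₀ * C₀)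
  k*[c₁*C₁]≤q*[c₀*C₀] {c₀} {c₁} {k} {n} {C₀} {C₁} c₀n≢0 nC₁≤kC₀ = *-cancelˡ-≤-pos n (begin
    n * (k * (c₁ * C₁))           ≡⟨ solve (c₁ ∷ k ∷ n ∷ C₁ ∷ []) ℚ-ring ⟩
    c₁ * k * (n * C₁)             ≤⟨ *-monoˡ-≤-nonNeg (c₁ * k) nC₁≤kC₀ ⟩
    c₁ * k * (k * C₀)             ≡⟨ solve (c₁ ∷ k ∷ C₀ ∷ []) ℚ-ring ⟩
    c₁ * (k * k) * C₀             ≡⟨ cong (_* C₀) (p/?q*q≡p _ (c₀ * n) c₀n≢0) ⟨
    q * (c₀ * n) * C₀             ≡⟨ rearrange q c₀ n C₀ ⟩
    n * (q * (c₀ * C₀))           ∎)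
    where
    open ≤-Reasoning
    q = (c₁ * (k * k)) /? (c₀ * n)
    instance _ = nonNeg*nonNeg⇒nonNeg c₁ k
    rearrange : ∀ a b c d → a * (b * c) * d ≡ c * (a * (b * d))
    rearrange = solve-∀ ℚ-ring

  ⟦L⟧-c*⟦k⟧*⟦C⟧≤⟦E⟧ : ∀ (c : ℚ) L E k C M → c * ⟦ C ⟧ ≡ ⟦ M ⟧ → L ℕ.≤ E ℕ.+ k ℕ.* M →
    ⟦ L ⟧ - c * ⟦ k ⟧ * ⟦ C ⟧ ≤ ⟦ E ⟧
  ⟦L⟧-c*⟦k⟧*⟦C⟧≤⟦E⟧ c L E k C M c⟦C⟧≡⟦M⟧ L≤E+kM = p≤q+r⇒p-r≤q (begin
    ⟦ L ⟧                       ≤⟨ ⟦⟧-mono-≤ L≤E+kM ⟩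
    ⟦ E ℕ.+ k ℕ.* M ⟧           ≡⟨ trans (⟦⟧-homo-+ E _) (cong (λ x → ⟦ E ⟧ + x) (⟦⟧-homo-* k M)) ⟩
    ⟦ E ⟧ + ⟦ k ⟧ * ⟦ M ⟧       ≡⟨ cong (λ m → ⟦ E ⟧ + ⟦ k ⟧ * m) c⟦C⟧≡⟦M⟧ ⟨
    ⟦ E ⟧ + ⟦ k ⟧ * (c * ⟦ C ⟧) ≡⟨ cong (λ x → ⟦ E ⟧ + x) (*-assoc ⟦ k ⟧ c ⟦ C ⟧) ⟨
    ⟦ E ⟧ + ⟦ k ⟧ * c * ⟦ C ⟧   ≡⟨ cong (λ x → ⟦ E ⟧ + x * ⟦ C ⟧) (*-comm ⟦ k ⟧ c) ⟩
    ⟦ E ⟧ + c * ⟦ k ⟧ * ⟦ C ⟧   ∎)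
    where open ≤-Reasoning

  [1-q]*⟦L⟧*⟦A⟧≤⟦E⟧ : ∀ (c₀ c₁ : ℚ) L A E k n C₀ C₁ M → 0ℚ ≤ c₁ → 0 ℕ.< n →
    ⟦ L ⟧ ≡ c₀ * ⟦ C₀ ⟧ → c₁ * ⟦ C₁ ⟧ ≡ ⟦ M ⟧ → n ℕ.* C₁ ℕ.≤ k ℕ.* C₀ →
    L ℕ.* A ℕ.≤ E ℕ.+ A ℕ.* (k ℕ.* M) →
    (1ℚ - (c₁ * ⟦ k ℕ.* k ⟧) /? (c₀ * ⟦ n ⟧)) * ⟦ L ⟧ * ⟦ A ⟧ ≤ ⟦ E ⟧
  [1-q]*⟦L⟧*⟦A⟧≤⟦E⟧ c₀ c₁ L A E k n C₀ C₁ M c₁≥0 n>0 ⟦L⟧≡c₀⟦C₀⟧ c₁⟦C₁⟧≡⟦M⟧ nC₁≤kC₀ LA≤E+AkM =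
    by-cases (c₀ * ⟦ n ⟧ ≟ 0ℚ)
    where
    q = (c₁ * ⟦ k ℕ.* k ⟧) /? (c₀ * ⟦ n ⟧)
    instance
      _ = nonNegative c₁≥0
      _ = ⟦⟧-nonNeg k
      _ = ⟦⟧-nonNeg A
      _ = ℕ.>-nonZero n>0
      _ = ⟦⟧-pos n
      _ = pos⇒nonZero ⟦ n ⟧ {{⟦⟧-pos n}}
    by-cases : Dec (c₀ * ⟦ n ⟧ ≡ 0ℚ) → (1ℚ - q) * ⟦ L ⟧ * ⟦ A ⟧ ≤ ⟦ E ⟧
    -- If c₀ n = 0 then c₀ = 0 and L = 0, so the junk value of _/?_ at 0 is irrelevant.
    by-cases (yes c₀n≡0) = begin
      (1ℚ - q) * ⟦ L ⟧ * ⟦ A ⟧ ≡⟨ cong (λ x → (1ℚ - q) * x * ⟦ A ⟧) ⟦L⟧≡0 ⟩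
      (1ℚ - q) * 0ℚ * ⟦ A ⟧    ≡⟨ cong (_* ⟦ A ⟧) (*-zeroʳ (1ℚ - q)) ⟩
      0ℚ * ⟦ A ⟧               ≡⟨ *-zeroˡ ⟦ A ⟧ ⟩
      0ℚ                       ≤⟨ nonNegative⁻¹ ⟦ E ⟧ {{⟦⟧-nonNeg E}} ⟩
      ⟦ E ⟧                    ∎
      where
      open ≤-Reasoning
      ⟦L⟧≡0 : ⟦ L ⟧ ≡ 0ℚ
      ⟦L⟧≡0 = trans ⟦L⟧≡c₀⟦C₀⟧ (trans (cong (_* ⟦ C₀ ⟧) (p*q≡0⇒p≡0 c₀ ⟦ n ⟧ c₀n≡0)) (*-zeroˡ ⟦ C₀ ⟧))
    by-cases (no c₀n≢0) = [1-q]*L*A≤E {q = q} LA≤E+Ad d≤qL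
      where
      open ≤-Reasoning
      LA≤E+Ad : ⟦ L ⟧ * ⟦ A ⟧ ≤ ⟦ E ⟧ + ⟦ A ⟧ * (⟦ k ⟧ * (c₁ * ⟦ C₁ ⟧))
      LA≤E+Ad = begin
        ⟦ L ⟧ * ⟦ A ⟧                            ≡⟨ ⟦⟧-homo-* L A ⟨
        ⟦ L ℕ.* A ⟧                              ≤⟨ ⟦⟧-mono-≤ LA≤E+AkM ⟩
        ⟦ E ℕ.+ A ℕ.* (k ℕ.* M) ⟧                ≡⟨ ⟦⟧-homo-+ E _ ⟩
        ⟦ E ⟧ + ⟦ A ℕ.* (k ℕ.* M) ⟧              ≡⟨ cong (λ x → ⟦ E ⟧ + x)
                                                      (trans (⟦⟧-homo-* A _) (cong (⟦ A ⟧ *_) (⟦⟧-homo-* k M))) ⟩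
        ⟦ E ⟧ + ⟦ A ⟧ * (⟦ k ⟧ * ⟦ M ⟧)          ≡⟨ cong (λ x → ⟦ E ⟧ + ⟦ A ⟧ * (⟦ k ⟧ * x)) c₁⟦C₁⟧≡⟦M⟧ ⟨
        ⟦ E ⟧ + ⟦ A ⟧ * (⟦ k ⟧ * (c₁ * ⟦ C₁ ⟧)) ∎
      d≤qL : ⟦ k ⟧ * (c₁ * ⟦ C₁ ⟧) ≤ q * ⟦ L ⟧
      d≤qL = begin
        ⟦ k ⟧ * (c₁ * ⟦ C₁ ⟧)
          ≤⟨ k*[c₁*C₁]≤q*[c₀*C₀] {c₀} {c₁} {⟦ k ⟧} {⟦ n ⟧} {⟦ C₀ ⟧} {⟦ C₁ ⟧} c₀n≢0 ⟦n⟧⟦C₁⟧≤⟦k⟧⟦C₀⟧ ⟩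
        ((c₁ * (⟦ k ⟧ * ⟦ k ⟧)) /? (c₀ * ⟦ n ⟧)) * (c₀ * ⟦ C₀ ⟧)
          ≡⟨ cong₂ (λ x y → ((c₁ * x) /? (c₀ * ⟦ n ⟧)) * y) (⟦⟧-homo-* k k) ⟦L⟧≡c₀⟦C₀⟧ ⟨
        q * ⟦ L ⟧ ∎
        where
        ⟦n⟧⟦C₁⟧≤⟦k⟧⟦C₀⟧ : ⟦ n ⟧ * ⟦ C₁ ⟧ ≤ ⟦ k ⟧ * ⟦ C₀ ⟧
        ⟦n⟧⟦C₁⟧≤⟦k⟧⟦C₀⟧ = subst₂ _≤_ (⟦⟧-homo-* n C₁) (⟦⟧-homo-* k C₀) (⟦⟧-mono-≤ nC₁≤kC₀)

open Counting using (size-link≤e₁+k*maxLink; size-link*size-avoid≤e+size-avoid*k*maxLink)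
open Binomial using (nCk>0; n*[n∸i∸1]C[k∸i∸1]≤k*[n∸i]C[k∸i])
open Rational using (c*C≡maxLink; c≥0; ⟦L⟧-c*⟦k⟧*⟦C⟧≤⟦E⟧; [1-q]*⟦L⟧*⟦A⟧≤⟦E⟧)

open import Data.Bool using (true)
open import Data.Nat using (ℕ; _≤_; _<_; _*_; _∸_; _+_; z≤n)
open import Data.Nat.Properties using (≤-trans; m≤m+n; <-≤-trans; ≤-<-trans; ∸-+-assoc; ∸-monoˡ-≤)
open import Data.Nat.Combinatorics using (_C_)
open import Data.Fin.Subset using (Subset; ∣_∣)
open import Data.Rational using (ℚ; 1ℚ) renaming (_≤_ to _≤ℚ_; _*_ to _*ℚ_; _-_ to _-ℚ_)
open import Relation.Binary.PropositionalEquality using (_≡_)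
open import Data.Product using (_×_; _,_)

lemma2 : (n k : ℕ) → 2 * k ≤ n → 1 < 2 * k →
    (𝓕 : Family n) → Uniform 𝓕 k → (n ∸ 1) C (k ∸ 1) < size 𝓕 →
    (i : ℕ) → 1 ≤ i → i < k →
    (P : Subset n) → ∣ P ∣ ≡ i →
    ⟦ size (link 𝓕 P) ⟧ ≡ c k 𝓕 i *ℚ ⟦ (n ∸ i) C (k ∸ i) ⟧ →
    ((H : Subset n) → avoid 𝓕 P H ≡ true →
      (⟦ size (link 𝓕 P) ⟧ -ℚ c k 𝓕 (i + 1) *ℚ ⟦ k ⟧ *ℚ ⟦ (n ∸ i ∸ 1) C (k ∸ i ∸ 1) ⟧)
        ≤ℚ ⟦ e₁ (link 𝓕 P) H ⟧)
    × ((1ℚ -ℚ ((c k 𝓕 (i + 1) *ℚ ⟦ k * k ⟧) /? (c k 𝓕 i *ℚ ⟦ n ⟧)))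
          *ℚ ⟦ size (link 𝓕 P) ⟧ *ℚ ⟦ size (avoid 𝓕 P) ⟧
        ≤ℚ ⟦ e (link 𝓕 P) (avoid 𝓕 P) ⟧)
lemma2 n k 2k≤n _ 𝓕 uniform _ i _ i<k P ∣P∣≡i ∣𝓕[P]∣≡c[i]C₀ =
    (λ H H∈𝓕[P̄] → ⟦L⟧-c*⟦k⟧*⟦C⟧≤⟦E⟧ c[i+1] L (e₁ (link 𝓕 P) H) k C₁ M c[i+1]C₁≡M
                    (size-link≤e₁+k*maxLink 𝓕 uniform P ∣P∣≡i H H∈𝓕[P̄]))
  , [1-q]*⟦L⟧*⟦A⟧≤⟦E⟧ (c k 𝓕 i) c[i+1] L A (e (link 𝓕 P) (avoid 𝓕 P)) k n C₀ C₁ M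
      (c≥0 k 𝓕 (i + 1)) n>0 ∣𝓕[P]∣≡c[i]C₀ c[i+1]C₁≡M
      (n*[n∸i∸1]C[k∸i∸1]≤k*[n∸i]C[k∸i] i<k k≤n)
      (size-link*size-avoid≤e+size-avoid*k*maxLink 𝓕 uniform P ∣P∣≡i)
  where
  L = size (link 𝓕 P)
  A = size (avoid 𝓕 P)
  C₀ = (n ∸ i) C (k ∸ i)
  C₁ = (n ∸ i ∸ 1) C (k ∸ i ∸ 1)
  M = maxLink 𝓕 (i + 1)
  c[i+1] = c k 𝓕 (i + 1)
  k≤n : k ≤ n
  k≤n = ≤-trans (m≤m+n k (k + 0)) 2k≤n
  n>0 : 0 < n
  n>0 = <-≤-trans (≤-<-trans z≤n i<k) k≤n
  c[i+1]C₁≡M : c[i+1] *ℚ ⟦ C₁ ⟧ ≡ ⟦ M ⟧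
  c[i+1]C₁≡M rewrite ∸-+-assoc n i 1 | ∸-+-assoc k i 1 =
    c*C≡maxLink k 𝓕 (i + 1) (nCk>0 (∸-monoˡ-≤ (i + 1) k≤n))
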